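{- For each $k\ge1$, the classification strategy $\mathcal{O}_k$ is optimal: among all classification strategies, it minimizes the average number of comparisons $\mathrm{E}(P_n)$ needed to classify the $n-k$ non-pivot elements.
   Context: Input: a uniformly random permutation $(e_1,\dots,e_n)$ of $\{1,\dots,n\}$, $n>k$; pivots $p_1<\dots<p_k$ are $e_1,\dots,e_k$ sorted, $p_0=0,p_{k+1}=n+1$; $x$ belongs to group $A_h$ if $p_h<x<p_{h+1}$, and $a_h=p_{h+1}-p_h-1$. A comparison tree is a binary search tree with inner nodes labeled $p_1,\dots,p_k$ in inorder and leaves $A_0,\dots,A_k$ left to right; classifying an $A_h$-element with tree $\lambda$ costs $\mathrm{depth}_\lambda(A_h)$ comparisons. For nonnegative integers $a'_0,\dots,a'_k$, $\mathrm{cost}^\lambda(a'_0,\dots,a'_k)=\sum_i \mathrm{depth}_\lambda(A_i)a'_i$. A classification strategy classifies the elements $e_{k+1},\dots,e_n$ one after another; it is described, for each choice of pivots, by a classification tree: a $(k+1)$-ary tree with $n-k$ levels of inner nodes, each inner node $v$ carrying the index $i(v)$ of the element classified there and the comparison tree $\lambda(v)$ used for it, edges labeled by the outcome group $0,\dots,k$, each index occurring exactly once on each root-to-leaf path. For a node $v$, $a^v_h$ is the number of edges labeled $h$ on the path from the root to $v$ (the number of $A_h$-elements classified so far). Strategy $\mathcal{O}_k$ uses at each node $v$ a comparison tree $\lambda(v)$ that minimizes $\mathrm{cost}^\lambda(a_0-a^v_0,\dots,a_k-a^v_k)$ over all comparison trees $\lambda$ (it is given the group sizes $a_0,\dots,a_k$).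 -}

module Defs where

open import Data.Nat using (ℕ; zero; suc; _+_; _*_; _∸_; _≤_; _<_; _≤ᵇ_; _<ᵇ_; _≡ᵇ_; _!)
open import Data.Nat.Properties using (_!≢0)
open import Data.Bool using (Bool; if_then_else_)
open import Data.Fin using (Fin; zero; suc; toℕ; _≟_)
open import Data.List using (List; []; _∷_; map; concatMap; applyUpTo; take; filterᵇ; allFin)
open import Data.Bool.ListAction using (any)
open import Data.Nat.ListAction using (sum)
open import Data.List.Membership.Propositional using (_∈_)
open import Data.Integer using (+_)
open import Data.Rational using (ℚ; _/_)
open import Data.Product using (_×_)
open import Data.Unit using (⊤)
open import Relation.Nullary using (¬_; yes; no)

insertAll : ℕ → List ℕ → List (List ℕ)
insertAll x []       = (x ∷ []) ∷ []
insertAll x (y ∷ ys) = (x ∷ y ∷ ys) ∷ map (y ∷_) (insertAll x ys)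

permsOf : List ℕ → List (List ℕ)
permsOf []       = [] ∷ []
permsOf (x ∷ xs) = concatMap (insertAll x) (permsOf xs)

inputs : ℕ → List (List ℕ)
inputs n = permsOf (applyUpTo suc n)

-- e_i (1-indexed; default 0 out of range)
elemAt : List ℕ → ℕ → ℕ
elemAt []       _             = 0
elemAt (x ∷ xs) zero          = 0
elemAt (x ∷ xs) (suc zero)    = x
elemAt (x ∷ xs) (suc (suc i)) = elemAt xs (suc i)

-- sorted pivots p₁ < … < p_k : the values in 1..n occurring among e₁,…,e_k
pivots : ℕ → ℕ → List ℕ → List ℕ
pivots n k e = filterᵇ (λ x → any (λ y → x ≡ᵇ y) (take k e)) (applyUpTo suc n)

-- p_j with p₀ = 0 and p_{k+1} = n+1  (ps = [p₁,…,p_k])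
pivotAt : ℕ → List ℕ → ℕ → ℕ
pivotAt n ps       zero    = 0
pivotAt n []       (suc j) = suc n
pivotAt n (p ∷ ps) (suc zero) = p
pivotAt n (p ∷ ps) (suc (suc j)) = pivotAt n ps (suc j)

groupSize : ℕ → (k : ℕ) → List ℕ → Fin (suc k) → ℕ
groupSize n k ps h = pivotAt n ps (suc (toℕ h)) ∸ pivotAt n ps (toℕ h) ∸ 1

-- group of x: the h with p_h < x < p_{h+1}, i.e. the number of pivots below x
-- (ps sorted increasingly; count capped at k)
groupOf : (k : ℕ) → List ℕ → ℕ → Fin (suc k)
groupOf zero    _        x = zero
groupOf (suc k) []       x = zero
groupOf (suc k) (p ∷ ps) x = if p <ᵇ x then suc (groupOf k ps x) else groupOf (suc k) ps x

-- Comparison trees: binary search trees with m inner nodes (labelled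
-- p₁,…,p_m in inorder) and m+1 leaves A₀,…,A_m from left to right.

data CompTree : ℕ → Set where
  leaf : CompTree 0
  node : ∀ {l r} → CompTree l → CompTree r → CompTree (suc (l + r))

-- depth of leaf A_h (root has depth 0): number of comparisons
depth : ∀ {m} → CompTree m → ℕ → ℕ
depth leaf               h = 0
depth (node {l} lt rt) h = suc (if h ≤ᵇ l then depth lt h else depth rt (h ∸ suc l))

cost : ∀ {k} → CompTree k → (Fin (suc k) → ℕ) → ℕ
cost {k} λt a′ = sum (map (λ i → depth λt (toℕ i) * a′ i) (allFin (suc k)))

-- Classification trees: (k+1)-ary trees with d levels of inner nodes;
-- inner node = (index i(v) of element classified, comparison tree λ(v)),
-- children indexed by outcome group 0..k.

data ClassTree (k : ℕ) : ℕ → Set where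
  leaf : ClassTree k 0
  node : ∀ {d} → (i : ℕ) → CompTree k → (Fin (suc k) → ClassTree k d) → ClassTree k (suc d)

-- index condition: indices lie in {k+1,…,n} and never repeat on a path.
-- With n-k levels this is "each index occurs exactly once on each path".
ValidCT : ∀ {d} → ℕ → (k : ℕ) → List ℕ → ClassTree k d → Set
ValidCT n k used leaf             = ⊤
ValidCT n k used (node i λt ch) =
  (k < i × i ≤ n) × (¬ (i ∈ used)) × (∀ h → ValidCT n k (i ∷ used) (ch h))

-- a classification strategy: for each choice of (sorted) pivots a classification tree
Strategy : ℕ → ℕ → Set
Strategy n k = List ℕ → ClassTree k (n ∸ k)

IsStrategy : (n k : ℕ) → Strategy n k → Set
IsStrategy n k S = ∀ e → e ∈ inputs n → ValidCT n k [] (S (pivots n k e))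

run : ∀ {k d} → ClassTree k d → (ℕ → Fin (suc k)) → ℕ
run leaf            g = 0
run (node i λt ch) g = depth λt (toℕ (g i)) + run (ch (g i)) g

comparisons : (n k : ℕ) → Strategy n k → List ℕ → ℕ
comparisons n k S e = run (S ps) (λ i → groupOf k ps (elemAt e i))
  where ps = pivots n k e

expectedCost : (n k : ℕ) → Strategy n k → ℚ
expectedCost n k S =
  _/_ (+ sum (map (comparisons n k S) (inputs n))) (n !) {{n !≢0}}

-- Strategy O_k: at every node v, λ(v) minimizes cost^λ(a₀-a^v₀,…,a_k-a^v_k).
-- The argument a′ carries a - a^v (decremented along the edge labels).

decAt : ∀ {k} → (Fin (suc k) → ℕ) → Fin (suc k) → Fin (suc k) → ℕ
decAt a h j with j ≟ h
... | yes _ = a j ∸ 1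
... | no  _ = a j

OptNodes : ∀ {k d} → (Fin (suc k) → ℕ) → ClassTree k d → Set
OptNodes a′ leaf             = ⊤
OptNodes {k} a′ (node i λt ch) =
  (∀ (μ : CompTree k) → cost λt a′ ≤ cost μ a′) × (∀ h → OptNodes (decAt a′ h) (ch h))

IsOk : (n k : ℕ) → Strategy n k → Set
IsOk n k S = ∀ e → e ∈ inputs n →
  OptNodes (groupSize n k (pivots n k e)) (S (pivots n k e))

module Submission where

-- Fix a pivot list P and let L be the inputs with pivots P.  The trees O P and
-- T = X P are compared on L by an exchange argument, by induction on the trees,
-- under the invariant ("balanced") that L is closed under swapping two positions
-- still to be classified and that every input of L has the same vector a′ of
-- unclassified elements per group.  Relabelling T by the transposition of the two
-- root positions does not change its total cost (symmetry), so both roots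
-- classify the same position i.  By symmetry and double counting, the total cost
-- of a comparison tree at the root is proportional to its cost for a′, which O
-- minimises; the children are compared on the fibres of L by the group of e_i,
-- which are balanced again.

open import Defs
open import Data.Nat using (ℕ; zero; suc; _+_; _*_; _∸_; _⊓_; _≤_; _<_; z≤n; s≤s; _≟_; _<?_; _<ᵇ_; _≡ᵇ_; NonZero; _!)
open import Data.Nat.Properties
open import Algebra.Properties.CommutativeSemigroup +-commutativeSemigroup using () renaming (interchange to +-interchange)
open import Data.Nat.ListAction using (sum)
open import Data.Nat.ListAction.Properties using (sum-↭; sum-++)
open import Data.Bool using (Bool; true; false; if_then_else_; T)
open import Data.Bool.Properties using (T-≡)
open import Data.Bool.ListAction using (any)
open import Data.Fin using (Fin; zero; suc; toℕ) renaming (_≟_ to _≟ᶠ_)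
import Data.Integer as ℤ
import Data.Integer.Properties as ℤₚ
open import Data.Rational using (_/_; toℚᵘ; fromℚᵘ) renaming (_≤_ to _≤ℚ_)
open import Data.Rational.Properties using (toℚᵘ-cancel-≤; toℚᵘ-fromℚᵘ)
open import Data.Rational.Unnormalised using (mkℚᵘ; *≤*)
import Data.Rational.Unnormalised.Properties as ℚᵘ
open import Data.List
  using (List; []; _∷_; map; _++_; length; filter; filterᵇ; deduplicate; concatMap; applyUpTo; allFin; take; drop)
open import Data.List.Properties
  using (map-++; map-∘; length-map; length-applyUpTo; ∷-injective; filter-accept; filter-reject; filter-all;
         take++drop≡id; length-take; ≡-dec)
open import Data.List.Membership.Propositional using (_∈_; _∉_; find)
open import Data.List.Membership.DecPropositional _≟_ using (_∈?_)
open import Data.List.Membership.Propositional.Properties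
  using (∈-filter⁻; ∈-filter⁺; ∈-deduplicate⁻; ∈-deduplicate⁺; ∈-map⁻; ∈-map⁺; ∈-concatMap⁺; ∈-concatMap⁻;
         ∈-∃++; ∈-++⁺ʳ; ∈-allFin)
open import Data.List.Membership.Propositional.Properties.WithK using (unique∧set⇒bag)
open import Data.List.Relation.Unary.Any using (here; there)
import Data.List.Relation.Unary.Any as Any
open import Data.List.Relation.Unary.Any.Properties using (any⁺; any⁻)
open import Data.List.Relation.Unary.All using (All; []; _∷_)
import Data.List.Relation.Unary.All as All
open import Data.List.Relation.Unary.Unique.Propositional using (Unique; []; _∷_)
import Data.List.Relation.Unary.Unique.Propositional.Properties as Unique
import Data.List.Relation.Unary.Unique.DecPropositional.Properties as Dedup
open import Data.List.Relation.Binary.Disjoint.Propositional using (Disjoint)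
open import Data.List.Relation.Binary.Permutation.Propositional
  using (_↭_; ↭-refl; ↭-sym; ↭-trans; ↭-prep; ↭-swap; ↭⇒↭ₛ)
import Data.List.Relation.Binary.Permutation.Propositional.Properties as ↭
open import Data.List.Relation.Binary.BagAndSetEquality using (∼bag⇒↭)
open import Data.Product using (_×_; _,_; proj₁; proj₂)
open import Function using (_∘_; _⇔_; mk⇔; Equivalence; case_of_)
open import Relation.Nullary using (Dec; yes; no; does; ¬?; contradiction)
open import Relation.Nullary.Decidable using (dec-true; dec-false; T?)
open import Relation.Unary using (Decidable)
open import Relation.Binary.Definitions using (DecidableEquality)
open import Relation.Binary.PropositionalEquality

private variable
  A B : Set

∑ : List A → (A → ℕ) → ℕ
∑ L f = sum (map f L)

𝟙 : ∀ {P : Set} → Dec P → ℕ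
𝟙 d = if does d then 1 else 0

∑-cong : (L : List A) {f g : A → ℕ} → (∀ {x} → x ∈ L → f x ≡ g x) → ∑ L f ≡ ∑ L g
∑-cong []      eq = refl
∑-cong (x ∷ L) eq = cong₂ _+_ (eq (here refl)) (∑-cong L (eq ∘ there))

∑-mono : (L : List A) {f g : A → ℕ} → (∀ {x} → x ∈ L → f x ≤ g x) → ∑ L f ≤ ∑ L g
∑-mono []      le = z≤n
∑-mono (x ∷ L) le = +-mono-≤ (le (here refl)) (∑-mono L (le ∘ there))

∑-zero : (L : List A) → ∑ L (λ _ → 0) ≡ 0
∑-zero []      = refl
∑-zero (x ∷ L) = ∑-zero L

∑-+ : (L : List A) (f g : A → ℕ) → ∑ L (λ x → f x + g x) ≡ ∑ L f + ∑ L g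
∑-+ []      f g = refl
∑-+ (x ∷ L) f g = trans (cong (f x + g x +_) (∑-+ L f g)) (+-interchange (f x) (g x) _ _)

∑-*ˡ : (L : List A) (c : ℕ) (f : A → ℕ) → ∑ L (λ x → c * f x) ≡ c * ∑ L f
∑-*ˡ []      c f = sym (*-zeroʳ c)
∑-*ˡ (x ∷ L) c f = trans (cong (c * f x +_) (∑-*ˡ L c f)) (sym (*-distribˡ-+ c (f x) (∑ L f)))

∑-const : (L : List A) (c : ℕ) → ∑ L (λ _ → c) ≡ length L * c
∑-const []      c = refl
∑-const (x ∷ L) c = cong (c +_) (∑-const L c)

∑-comm : (L : List A) (M : List B) (f : A → B → ℕ) →
         ∑ L (λ x → ∑ M (f x)) ≡ ∑ M (λ y → ∑ L (λ x → f x y))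
∑-comm []      M f = sym (∑-zero M)
∑-comm (x ∷ L) M f = trans (cong (∑ M (f x) +_) (∑-comm L M f))
                           (sym (∑-+ M (f x) (λ y → ∑ L (λ x′ → f x′ y))))

∑-↭ : {L M : List A} (f : A → ℕ) → L ↭ M → ∑ L f ≡ ∑ M f
∑-↭ f L↭M = sum-↭ (↭.map⁺ f L↭M)

∑-map : (L : List A) (g : A → B) (f : B → ℕ) → ∑ (map g L) f ≡ ∑ L (f ∘ g)
∑-map L g f = cong sum (sym (map-∘ L))

∑-++ : (L M : List A) (f : A → ℕ) → ∑ (L ++ M) f ≡ ∑ L f + ∑ M f
∑-++ L M f = trans (cong sum (map-++ f L M)) (sum-++ (map f L) (map f M))

∑-filter : {P : A → Set} (P? : Decidable P) (L : List A) (f : A → ℕ) →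
           ∑ (filter P? L) f ≡ ∑ L (λ x → if does (P? x) then f x else 0)
∑-filter P? []      f = refl
∑-filter P? (x ∷ L) f with does (P? x)
... | true  = cong (f x +_) (∑-filter P? L f)
... | false = ∑-filter P? L f

count : {P : A → Set} → Decidable P → List A → ℕ
count P? L = ∑ L (λ x → 𝟙 (P? x))

∑-filter-const : {P : A → Set} (P? : Decidable P) (L : List A) (c : ℕ) →
                 ∑ (filter P? L) (λ _ → c) ≡ count P? L * c
∑-filter-const P? L c = begin
  ∑ (filter P? L) (λ _ → c)                   ≡⟨ ∑-filter P? L (λ _ → c) ⟩
  ∑ L (λ x → if does (P? x) then c else 0)    ≡⟨ ∑-cong L (λ {x} _ → truncate (P? x)) ⟩
  ∑ L (λ x → c * 𝟙 (P? x))                    ≡⟨ ∑-*ˡ L c (λ x → 𝟙 (P? x)) ⟩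
  c * count P? L                              ≡⟨ *-comm c _ ⟩
  count P? L * c                              ∎
  where
  open ≡-Reasoning
  truncate : ∀ {Q : Set} (d : Dec Q) → (if does d then c else 0) ≡ c * 𝟙 d
  truncate (yes _) = sym (*-identityʳ c)
  truncate (no _)  = sym (*-zeroʳ c)

∑-sift : (_≟_ : DecidableEquality B) {Bs : List B} → Unique Bs → ∀ {b} → b ∈ Bs → (f : B → ℕ) →
         ∑ Bs (λ c → if does (b ≟ c) then f c else 0) ≡ f b
∑-sift _≟_ {b ∷ Cs} (b∉Cs ∷ _) (here refl) f = begin
  (if does (b ≟ b) then f b else 0) + ∑ Cs (λ c → if does (b ≟ c) then f c else 0)
    ≡⟨ cong₂ _+_ (cong (λ t → if t then f b else 0) (dec-true (b ≟ b) refl)) missed ⟩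
  f b + 0 ≡⟨ +-identityʳ (f b) ⟩
  f b     ∎
  where
  open ≡-Reasoning
  missed : ∑ Cs (λ c → if does (b ≟ c) then f c else 0) ≡ 0
  missed = trans (∑-cong Cs (λ {c} c∈Cs → cong (λ t → if t then f c else 0)
                                (dec-false (b ≟ c) (All.lookup b∉Cs c∈Cs))))
                 (∑-zero Cs)
∑-sift _≟_ {c ∷ Cs} (c∉Cs ∷ uCs) {b} (there b∈Cs) f =
  cong₂ _+_ (cong (λ t → if t then f c else 0) (dec-false (b ≟ c) (λ { refl → All.lookup c∉Cs b∈Cs refl })))
            (∑-sift _≟_ uCs b∈Cs f)

fibre : (_≟_ : DecidableEquality B) (g : A → B) → B → List A → List A
fibre _≟_ g b = filter (λ x → g x ≟ b)

∑-fibres : (_≟_ : DecidableEquality B) (g : A → B) {Bs : List B} → Unique Bs →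
           (L : List A) → (∀ {x} → x ∈ L → g x ∈ Bs) → (G : A → B → ℕ) →
           ∑ L (λ x → G x (g x)) ≡ ∑ Bs (λ b → ∑ (fibre _≟_ g b L) (λ x → G x b))
∑-fibres _≟_ g {Bs} uBs L g∈Bs G = begin
  ∑ L (λ x → G x (g x))
    ≡⟨ ∑-cong L (λ x∈L → sym (∑-sift _≟_ uBs (g∈Bs x∈L) (G _))) ⟩
  ∑ L (λ x → ∑ Bs (λ b → if does (g x ≟ b) then G x b else 0))
    ≡⟨ ∑-comm L Bs _ ⟩
  ∑ Bs (λ b → ∑ L (λ x → if does (g x ≟ b) then G x b else 0))
    ≡⟨ ∑-cong Bs (λ {b} _ → sym (∑-filter (λ x → g x ≟ b) L (λ x → G x b))) ⟩
  ∑ Bs (λ b → ∑ (fibre _≟_ g b L) (λ x → G x b)) ∎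
  where open ≡-Reasoning

∑-≤-fibrewise : (_≟_ : DecidableEquality B) (g : A → B) (L : List A) {F G : A → ℕ} →
                (∀ {x} → x ∈ L → ∑ (fibre _≟_ g (g x) L) F ≤ ∑ (fibre _≟_ g (g x) L) G) →
                ∑ L F ≤ ∑ L G
∑-≤-fibrewise _≟_ g L {F} {G} fibre-≤ = begin
  ∑ L F                                 ≡⟨ ∑-fibres _≟_ g uBs L g∈Bs (λ x _ → F x) ⟩
  ∑ Bs (λ b → ∑ (fibre _≟_ g b L) F)    ≤⟨ ∑-mono Bs on-fibre ⟩
  ∑ Bs (λ b → ∑ (fibre _≟_ g b L) G)    ≡⟨ ∑-fibres _≟_ g uBs L g∈Bs (λ x _ → G x) ⟨
  ∑ L G                                 ∎
  where
  open ≤-Reasoning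
  Bs = deduplicate _≟_ (map g L)
  uBs : Unique Bs
  uBs = Dedup.deduplicate-! _≟_ (map g L)
  g∈Bs : ∀ {x} → x ∈ L → g x ∈ Bs
  g∈Bs x∈L = ∈-deduplicate⁺ _≟_ (∈-map⁺ g x∈L)
  on-fibre : ∀ {b} → b ∈ Bs → ∑ (fibre _≟_ g b L) F ≤ ∑ (fibre _≟_ g b L) G
  on-fibre b∈Bs with ∈-map⁻ g (∈-deduplicate⁻ _≟_ (map g L) b∈Bs)
  ... | x , x∈L , refl = fibre-≤ x∈L

↭-by-elements : {xs ys : List A} → Unique xs → Unique ys → (∀ {z} → z ∈ xs ⇔ z ∈ ys) → xs ↭ ys
↭-by-elements uxs uys same = ∼bag⇒↭ (unique∧set⇒bag uxs uys same)

Invariant : {A : Set} → (A → A) → List A → Set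
Invariant {A} σ L = ∀ (F : A → ℕ) → ∑ L (F ∘ σ) ≡ ∑ L F

filter-invariant : {A : Set} {P : A → Set} (P? : Decidable P) {σ : A → A} {L : List A} →
                   (∀ {x} → x ∈ L → does (P? (σ x)) ≡ does (P? x)) →
                   Invariant σ L → Invariant σ (filter P? L)
filter-invariant {A} P? {σ} {L} P∘σ invariant F = begin
  ∑ (filter P? L) (F ∘ σ)                          ≡⟨ ∑-filter P? L (F ∘ σ) ⟩
  ∑ L (λ x → if does (P? x) then F (σ x) else 0)   ≡⟨ ∑-cong L (λ x∈L → cong (λ t → if t then _ else 0) (sym (P∘σ x∈L))) ⟩
  ∑ L (G ∘ σ)                                      ≡⟨ invariant G ⟩
  ∑ L G                                            ≡⟨ ∑-filter P? L F ⟨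
  ∑ (filter P? L) F                                ∎
  where
  open ≡-Reasoning
  G : A → ℕ
  G x = if does (P? x) then F x else 0

interval : ℕ → ℕ → List ℕ
interval lo zero    = []
interval lo (suc c) = suc lo ∷ interval (suc lo) c

∈-interval⁻ : ∀ lo c {j} → j ∈ interval lo c → lo < j × j ≤ lo + c
∈-interval⁻ lo (suc c) (here refl) = ≤-refl , ≤-trans (s≤s (m≤m+n lo c)) (≤-reflexive (sym (+-suc lo c)))
∈-interval⁻ lo (suc c) (there j∈) with ∈-interval⁻ (suc lo) c j∈
... | lo<j , j≤ = <-trans (n<1+n lo) lo<j , ≤-trans j≤ (≤-reflexive (sym (+-suc lo c)))

∈-interval⁺ : ∀ lo c {j} → lo < j → j ≤ lo + c → j ∈ interval lo c
∈-interval⁺ lo zero    lo<j j≤ = contradiction (≤-trans j≤ (≤-reflexive (+-identityʳ lo))) (<⇒≱ lo<j)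
∈-interval⁺ lo (suc c) {j} lo<j j≤ with j ≟ suc lo
... | yes refl = here refl
... | no  j≢   = there (∈-interval⁺ (suc lo) c (≤∧≢⇒< lo<j (j≢ ∘ sym)) (≤-trans j≤ (≤-reflexive (+-suc lo c))))

interval-unique : ∀ lo c → Unique (interval lo c)
interval-unique lo zero    = []
interval-unique lo (suc c) = All.tabulate (λ j∈ → <⇒≢ (proj₁ (∈-interval⁻ (suc lo) c j∈)))
                           ∷ interval-unique (suc lo) c

length-interval : ∀ lo c → length (interval lo c) ≡ c
length-interval lo zero    = refl
length-interval lo (suc c) = cong suc (length-interval (suc lo) c)

applyUpTo-suc : ∀ n → applyUpTo suc n ≡ interval 0 n
applyUpTo-suc n = shifted 0 n suc (λ _ → refl)
  where
  shifted : ∀ lo c (f : ℕ → ℕ) → (∀ x → f x ≡ suc (lo + x)) → applyUpTo f c ≡ interval lo c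
  shifted lo zero    f f≗ = refl
  shifted lo (suc c) f f≗ = cong₂ _∷_ (trans (f≗ 0) (cong suc (+-identityʳ lo)))
    (shifted (suc lo) c (f ∘ suc) (λ x → trans (f≗ (suc x)) (cong suc (+-suc lo x))))

transpose : ℕ → ℕ → ℕ → ℕ
transpose i j x with x ≟ i | x ≟ j
... | yes _ | _     = j
... | no _  | yes _ = i
... | no _  | no _  = x

transpose-left : ∀ i j → transpose i j i ≡ j
transpose-left i j with i ≟ i | i ≟ j
... | yes _   | _ = refl
... | no i≢i  | _ = contradiction refl i≢i

transpose-right : ∀ i j → transpose i j j ≡ i
transpose-right i j with j ≟ i | j ≟ j
... | yes j≡i | _       = j≡i
... | no _    | yes _   = refl
... | no _    | no j≢j  = contradiction refl j≢j

transpose-other : ∀ i j {x} → x ≢ i → x ≢ j → transpose i j x ≡ x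
transpose-other i j {x} x≢i x≢j with x ≟ i | x ≟ j
... | yes x≡i | _       = contradiction x≡i x≢i
... | no _    | yes x≡j = contradiction x≡j x≢j
... | no _    | no _    = refl

transpose-involutive : ∀ i j x → transpose i j (transpose i j x) ≡ x
transpose-involutive i j x with x ≟ i | x ≟ j
... | yes refl | _        = transpose-right x j
... | no _     | yes refl = transpose-left i x
... | no x≢i   | no x≢j   = transpose-other i j x≢i x≢j

transpose-injective : ∀ i j {x y} → transpose i j x ≡ transpose i j y → x ≡ y
transpose-injective i j {x} {y} eq =
  trans (sym (transpose-involutive i j x)) (trans (cong (transpose i j) eq) (transpose-involutive i j y))

transpose-closed : (P : ℕ → Set) → ∀ {i j x} → P i → P j → P x → P (transpose i j x)
transpose-closed P {i} {j} {x} Pi Pj Px with x ≟ i | x ≟ j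
... | yes _ | _     = Pj
... | no _  | yes _ = Pi
... | no _  | no _  = Px

Position : List ℕ → ℕ → Set
Position e i = 0 < i × i ≤ length e

elemAt-zero : ∀ e → elemAt e 0 ≡ 0
elemAt-zero []      = refl
elemAt-zero (_ ∷ _) = refl

elemAt-beyond : ∀ e {x} → length e ≤ x → elemAt e (suc x) ≡ 0
elemAt-beyond []      _         = refl
elemAt-beyond (_ ∷ e) (s≤s e≤x) = elemAt-beyond e e≤x

elemAt-map-applyUpTo : ∀ (f g : ℕ → ℕ) {m x} → x < m → elemAt (map f (applyUpTo g m)) (suc x) ≡ f (g x)
elemAt-map-applyUpTo f g {suc m} {zero}  _         = refl
elemAt-map-applyUpTo f g {suc m} {suc x} (s≤s x<m) = elemAt-map-applyUpTo f (g ∘ suc) x<m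

elemAt-ext : ∀ {a b} → length a ≡ length b → (∀ x → elemAt a (suc x) ≡ elemAt b (suc x)) → a ≡ b
elemAt-ext {[]}    {[]}    _   _  = refl
elemAt-ext {_ ∷ a} {_ ∷ b} len eq = cong₂ _∷_ (eq 0) (elemAt-ext (suc-injective len) (eq ∘ suc))

take-ext : ∀ k {a b} → length a ≡ length b → (∀ x → x < k → elemAt a (suc x) ≡ elemAt b (suc x)) →
           take k a ≡ take k b
take-ext zero    _   _  = refl
take-ext (suc k) {[]}    {[]}    _   _  = refl
take-ext (suc k) {_ ∷ a} {_ ∷ b} len eq =
  cong₂ _∷_ (eq 0 (s≤s z≤n)) (take-ext k (suc-injective len) (λ x x<k → eq (suc x) (s≤s x<k)))

length-readOff : ∀ (f : ℕ → ℕ) m → length (map f (applyUpTo suc m)) ≡ m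
length-readOff f m = trans (length-map f (applyUpTo suc m)) (length-applyUpTo suc m)

elemAt-readOff : ∀ (f : ℕ → ℕ) m → (∀ {y} → m ≤ y → f (suc y) ≡ 0) →
                 ∀ x → elemAt (map f (applyUpTo suc m)) (suc x) ≡ f (suc x)
elemAt-readOff f m vanish x with x <? m
... | yes x<m = elemAt-map-applyUpTo f suc x<m
... | no  x≮m = trans (elemAt-beyond (map f (applyUpTo suc m)) (≤-trans (≤-reflexive (length-readOff f m)) (≮⇒≥ x≮m)))
                      (sym (vanish (≮⇒≥ x≮m)))

map-elemAt : ∀ e → map (elemAt e) (applyUpTo suc (length e)) ≡ e
map-elemAt e = elemAt-ext (length-readOff (elemAt e) (length e)) (elemAt-readOff (elemAt e) (length e) (elemAt-beyond e))

swapAt : ℕ → ℕ → List ℕ → List ℕ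
swapAt i j e = map (elemAt e ∘ transpose i j) (applyUpTo suc (length e))

length-swapAt : ∀ i j e → length (swapAt i j e) ≡ length e
length-swapAt i j e = length-readOff (elemAt e ∘ transpose i j) (length e)

elemAt-swapAt : ∀ {i j} e → Position e i → Position e j → ∀ x → elemAt (swapAt i j e) x ≡ elemAt e (transpose i j x)
elemAt-swapAt {i} {j} e (0<i , _) (0<j , _) zero =
  trans (elemAt-zero (swapAt i j e))
        (sym (trans (cong (elemAt e) (transpose-other i j (<⇒≢ 0<i) (<⇒≢ 0<j))) (elemAt-zero e)))
elemAt-swapAt {i} {j} e (_ , i≤len) (_ , j≤len) (suc x) = elemAt-readOff (elemAt e ∘ transpose i j) (length e) vanish x
  where
  beyond : ∀ {p y} → p ≤ length e → length e ≤ y → suc y ≢ p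
  beyond p≤len len≤y refl = <⇒≱ (s≤s len≤y) p≤len
  vanish : ∀ {y} → length e ≤ y → elemAt e (transpose i j (suc y)) ≡ 0
  vanish len≤y = trans (cong (elemAt e) (transpose-other i j (beyond i≤len len≤y) (beyond j≤len len≤y)))
                       (elemAt-beyond e len≤y)

position-swapAt : ∀ i j e {p} → Position e p → Position (swapAt i j e) p
position-swapAt i j e (0<p , p≤len) = 0<p , ≤-trans p≤len (≤-reflexive (sym (length-swapAt i j e)))

swapAt-involutive : ∀ {i j} e → Position e i → Position e j → swapAt i j (swapAt i j e) ≡ e
swapAt-involutive {i} {j} e pi pj =
  elemAt-ext (trans (length-swapAt i j (swapAt i j e)) (length-swapAt i j e)) λ x → begin
    elemAt (swapAt i j (swapAt i j e)) (suc x)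
      ≡⟨ elemAt-swapAt (swapAt i j e) (position-swapAt i j e pi) (position-swapAt i j e pj) (suc x) ⟩
    elemAt (swapAt i j e) (transpose i j (suc x))
      ≡⟨ elemAt-swapAt e pi pj (transpose i j (suc x)) ⟩
    elemAt e (transpose i j (transpose i j (suc x)))
      ≡⟨ cong (elemAt e) (transpose-involutive i j (suc x)) ⟩
    elemAt e (suc x) ∎
  where open ≡-Reasoning

∈-positions⁻ : ∀ e {p} → p ∈ applyUpTo suc (length e) → Position e p
∈-positions⁻ e p∈ = ∈-interval⁻ 0 (length e) (subst (_ ∈_) (applyUpTo-suc (length e)) p∈)

∈-positions⁺ : ∀ e {p} → Position e p → p ∈ applyUpTo suc (length e)
∈-positions⁺ e (0<p , p≤len) = subst (_ ∈_) (sym (applyUpTo-suc (length e))) (∈-interval⁺ 0 (length e) 0<p p≤len)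

swapAt-↭ : ∀ {i j} e → Position e i → Position e j → swapAt i j e ↭ e
swapAt-↭ {i} {j} e pi pj = subst₂ _↭_ (sym (map-∘ U)) (map-elemAt e) (↭.map⁺ (elemAt e) transposed-↭)
  where
  U = applyUpTo suc (length e)
  U-unique : Unique U
  U-unique = subst Unique (sym (applyUpTo-suc (length e))) (interval-unique 0 (length e))
  transposed-↭ : map (transpose i j) U ↭ U
  transposed-↭ = ↭-by-elements (Unique.map⁺ (transpose-injective i j) U-unique) U-unique (mk⇔ to from)
    where
    to : ∀ {z} → z ∈ map (transpose i j) U → z ∈ U
    to z∈ with ∈-map⁻ (transpose i j) z∈
    ... | y , y∈U , refl = ∈-positions⁺ e (transpose-closed (Position e) pi pj (∈-positions⁻ e y∈U))
    from : ∀ {z} → z ∈ U → z ∈ map (transpose i j) U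
    from {z} z∈U = subst (_∈ map (transpose i j) U) (transpose-involutive i j z)
      (∈-map⁺ (transpose i j) (∈-positions⁺ e (transpose-closed (Position e) pi pj (∈-positions⁻ e z∈U))))

take-swapAt : ∀ {i j} k e → Position e i → Position e j → k < i → k < j → take k (swapAt i j e) ≡ take k e
take-swapAt {i} {j} k e pi pj k<i k<j = take-ext k (length-swapAt i j e) λ x x<k →
  trans (elemAt-swapAt e pi pj (suc x))
        (cong (elemAt e) (transpose-other i j (before k<i x<k) (before k<j x<k)))
  where
  before : ∀ {p x} → k < p → x < k → suc x ≢ p
  before k<p x<k refl = <⇒≱ x<k (≤-pred k<p)

concatMap-unique : (f : A → List B) {L : List A} → Unique L → (∀ {ℓ} → ℓ ∈ L → Unique (f ℓ)) →
                   (∀ {ℓ ℓ′ z} → ℓ ∈ L → ℓ′ ∈ L → z ∈ f ℓ → z ∈ f ℓ′ → ℓ ≡ ℓ′) →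
                   Unique (concatMap f L)
concatMap-unique f []              _       _      = []
concatMap-unique f {ℓ ∷ L} (ℓ∉L ∷ uL) blocks separated =
  Unique.++⁺ (blocks (here refl)) (concatMap-unique f uL (blocks ∘ there) (λ p q → separated (there p) (there q)))
             disjoint
  where
  disjoint : Disjoint (f ℓ) (concatMap f L)
  disjoint (z∈fℓ , z∈rest) with find (∈-concatMap⁻ f z∈rest)
  ... | ℓ′ , ℓ′∈L , z∈fℓ′ = All.lookup ℓ∉L ℓ′∈L (separated (here refl) (there ℓ′∈L) z∈fℓ z∈fℓ′)

insertAll-↭ : ∀ x ys {e} → e ∈ insertAll x ys → e ↭ x ∷ ys
insertAll-↭ x []       (here refl) = ↭-refl
insertAll-↭ x (y ∷ ys) (here refl) = ↭-refl
insertAll-↭ x (y ∷ ys) (there e∈) with ∈-map⁻ (y ∷_) e∈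
... | e′ , e′∈ , refl = ↭-trans (↭-prep y (insertAll-↭ x ys e′∈)) (↭-swap y x ↭-refl)

∈-insertAll : ∀ x as bs → as ++ x ∷ bs ∈ insertAll x (as ++ bs)
∈-insertAll x []       []       = here refl
∈-insertAll x []       (b ∷ bs) = here refl
∈-insertAll x (a ∷ as) bs       = there (∈-map⁺ (a ∷_) (∈-insertAll x as bs))

insertAll-unique : ∀ x ys → x ∉ ys → Unique (insertAll x ys)
insertAll-unique x []       _    = [] ∷ []
insertAll-unique x (y ∷ ys) x∉ =
  All.tabulate head-differs
  ∷ Unique.map⁺ (proj₂ ∘ ∷-injective) (insertAll-unique x ys (x∉ ∘ there))
  where
  head-differs : ∀ {e} → e ∈ map (y ∷_) (insertAll x ys) → x ∷ y ∷ ys ≢ e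
  head-differs e∈ refl with ∈-map⁻ (y ∷_) e∈
  ... | _ , _ , eq = x∉ (here (proj₁ (∷-injective eq)))

erase : ℕ → List ℕ → List ℕ
erase x = filter (λ y → ¬? (y ≟ x))

erase-head : ∀ x ys → x ∉ ys → erase x (x ∷ ys) ≡ ys
erase-head x ys x∉ = trans (filter-reject (λ y → ¬? (y ≟ x)) (λ x≢x → x≢x refl))
  (filter-all (λ y → ¬? (y ≟ x)) (All.tabulate (λ {y} y∈ y≡x → x∉ (subst (_∈ ys) y≡x y∈))))

erase-insertAll : ∀ x ys {e} → x ∉ ys → e ∈ insertAll x ys → erase x e ≡ ys
erase-insertAll x []       x∉ (here refl) = erase-head x [] x∉
erase-insertAll x (y ∷ ys) x∉ (here refl) = erase-head x (y ∷ ys) x∉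
erase-insertAll x (y ∷ ys) x∉ (there e∈) with ∈-map⁻ (y ∷_) e∈
... | e′ , e′∈ , refl = trans (filter-accept (λ z → ¬? (z ≟ x)) (λ { refl → x∉ (here refl) }))
                              (cong (y ∷_) (erase-insertAll x ys (x∉ ∘ there) e′∈))

∈-permsOf⁻ : ∀ xs {e} → e ∈ permsOf xs → e ↭ xs
∈-permsOf⁻ []       (here refl) = ↭-refl
∈-permsOf⁻ (x ∷ xs) e∈ with find (∈-concatMap⁻ (insertAll x) e∈)
... | ℓ , ℓ∈ , e∈ℓ = ↭-trans (insertAll-↭ x ℓ e∈ℓ) (↭-prep x (∈-permsOf⁻ xs ℓ∈))

∈-permsOf⁺ : ∀ xs {e} → e ↭ xs → e ∈ permsOf xs
∈-permsOf⁺ []       {[]}    _    = here refl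
∈-permsOf⁺ []       {y ∷ e} e↭[] with ↭.∈-resp-↭ e↭[] (here refl)
... | ()
∈-permsOf⁺ (x ∷ xs) {e} e↭ with ∈-∃++ (↭.∈-resp-↭ (↭-sym e↭) (here refl))
... | as , bs , refl = ∈-concatMap⁺ (insertAll x)
  (Any.map (λ { refl → ∈-insertAll x as bs }) (∈-permsOf⁺ xs (↭.drop-mid as [] e↭)))

permsOf-unique : ∀ xs → Unique xs → Unique (permsOf xs)
permsOf-unique []       _           = [] ∷ []
permsOf-unique (x ∷ xs) (x∉ ∷ uxs) =
  concatMap-unique (insertAll x) (permsOf-unique xs uxs)
    (λ ℓ∈ → insertAll-unique x _ (x∉perm ℓ∈))
    (λ ℓ∈ ℓ′∈ z∈ z∈′ → trans (sym (erase-insertAll x _ (x∉perm ℓ∈) z∈)) (erase-insertAll x _ (x∉perm ℓ′∈) z∈′))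
  where
  x∉perm : ∀ {ℓ} → ℓ ∈ permsOf xs → x ∉ ℓ
  x∉perm ℓ∈ x∈ℓ = All.lookup x∉ (↭.∈-resp-↭ (∈-permsOf⁻ xs ℓ∈) x∈ℓ) refl

map-unique : (f : A → B) {L : List A} → (∀ {x y} → x ∈ L → y ∈ L → f x ≡ f y → x ≡ y) →
             Unique L → Unique (map f L)
map-unique f     _   []       = []
map-unique f {x ∷ L} inj (x∉ ∷ u) = All.tabulate fresh ∷ map-unique f (λ p q → inj (there p) (there q)) u
  where
  fresh : ∀ {z} → z ∈ map f L → f x ≢ z
  fresh z∈ fx≡z with ∈-map⁻ f z∈
  ... | y , y∈L , refl = All.lookup x∉ y∈L (inj (here refl) (there y∈L) fx≡z)

∈-inputs⁻ : ∀ n {e} → e ∈ inputs n → e ↭ interval 0 n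
∈-inputs⁻ n e∈ = subst (_ ↭_) (applyUpTo-suc n) (∈-permsOf⁻ (applyUpTo suc n) e∈)

∈-inputs⁺ : ∀ n {e} → e ↭ interval 0 n → e ∈ inputs n
∈-inputs⁺ n e↭ = ∈-permsOf⁺ (applyUpTo suc n) (subst (_ ↭_) (sym (applyUpTo-suc n)) e↭)

inputs-unique : ∀ n → Unique (inputs n)
inputs-unique n = permsOf-unique (applyUpTo suc n) (subst Unique (sym (applyUpTo-suc n)) (interval-unique 0 n))

length-input : ∀ n {e} → e ∈ inputs n → length e ≡ n
length-input n e∈ = trans (↭.↭-length (∈-inputs⁻ n e∈)) (length-interval 0 n)

inputs-invariant : ∀ n {i j} → 0 < i → i ≤ n → 0 < j → j ≤ n → Invariant (swapAt i j) (inputs n)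
inputs-invariant n {i} {j} 0<i i≤n 0<j j≤n F =
  trans (sym (∑-map (inputs n) (swapAt i j) F)) (∑-↭ F swapped-↭)
  where
  I = inputs n
  pos : ∀ {e p} → e ∈ I → 0 < p → p ≤ n → Position e p
  pos e∈ 0<p p≤n = 0<p , ≤-trans p≤n (≤-reflexive (sym (length-input n e∈)))
  involutive : ∀ {e} → e ∈ I → swapAt i j (swapAt i j e) ≡ e
  involutive e∈ = swapAt-involutive _ (pos e∈ 0<i i≤n) (pos e∈ 0<j j≤n)
  closed : ∀ {e} → e ∈ I → swapAt i j e ∈ I
  closed e∈ = ∈-inputs⁺ n (↭-trans (swapAt-↭ _ (pos e∈ 0<i i≤n) (pos e∈ 0<j j≤n)) (∈-inputs⁻ n e∈))
  swapped-↭ : map (swapAt i j) I ↭ I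
  swapped-↭ = ↭-by-elements
    (map-unique (swapAt i j)
      (λ p q eq → trans (sym (involutive p)) (trans (cong (swapAt i j) eq) (involutive q)))
      (inputs-unique n))
    (inputs-unique n)
    (mk⇔ (λ z∈ → case ∈-map⁻ (swapAt i j) z∈ of λ { (e , e∈ , refl) → closed e∈ })
         (λ e∈ → subst (_∈ map (swapAt i j) I) (involutive e∈) (∈-map⁺ (swapAt i j) (closed e∈))))

boundary : ℕ → ℕ → List ℕ → ℕ → ℕ
boundary lo top P       zero          = lo
boundary lo top []      (suc j)       = suc top
boundary lo top (p ∷ P) (suc zero)    = p
boundary lo top (p ∷ P) (suc (suc j)) = boundary lo top P (suc j)

pivotAt≡boundary : ∀ n P j → pivotAt n P j ≡ boundary 0 n P j
pivotAt≡boundary n P       zero          = refl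
pivotAt≡boundary n []      (suc j)       = refl
pivotAt≡boundary n (p ∷ P) (suc zero)    = refl
pivotAt≡boundary n (p ∷ P) (suc (suc j)) = pivotAt≡boundary n P (suc j)

boundary-suc : ∀ lo lo′ top P j → boundary lo top P (suc j) ≡ boundary lo′ top P (suc j)
boundary-suc lo lo′ top []      j       = refl
boundary-suc lo lo′ top (p ∷ P) zero    = refl
boundary-suc lo lo′ top (p ∷ P) (suc j) = boundary-suc lo lo′ top P j

boundary-cons : ∀ lo top P j → boundary lo top (suc lo ∷ P) (suc j) ≡ boundary (suc lo) top P j
boundary-cons lo top P zero    = refl
boundary-cons lo top P (suc j) = boundary-suc lo (suc lo) top P j

groupOf-above : ∀ kk p P v → p < v → groupOf (suc kk) (p ∷ P) v ≡ suc (groupOf kk P v)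
groupOf-above kk p P v p<v with p <ᵇ v | <⇒<ᵇ p<v
... | true | _ = refl

groupOf-below : ∀ kk P v → All (v <_) P → groupOf kk P v ≡ zero
groupOf-below zero    P       v _              = refl
groupOf-below (suc kk) []     v _              = refl
groupOf-below (suc kk) (p ∷ P) v (v<p ∷ v<P) with p <ᵇ v in p<ᵇv
... | true  = contradiction (<ᵇ⇒< p v (subst T (sym p<ᵇv) _)) (<⇒≯ v<p)
... | false = groupOf-below (suc kk) P v v<P

gap-empty : ∀ lo → suc lo ∸ lo ∸ 1 ≡ 0
gap-empty zero     = refl
gap-empty (suc lo) = gap-empty lo

gap-extend : ∀ q lo → suc (suc lo) ≤ q → suc (q ∸ suc lo ∸ 1) ≡ q ∸ lo ∸ 1
gap-extend (suc (suc q)) zero     _         = refl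
gap-extend (suc q)       (suc lo) (s≤s le) = gap-extend q lo le

if-same : ∀ t → (if t then 0 else 0) ≡ 0
if-same true  = refl
if-same false = refl

∑-groupOf-above : ∀ c lo kk p P (b : ℕ → Bool) → p ≤ lo → ∀ h →
  ∑ (interval lo c) (λ v → if b v then 0 else 𝟙 (groupOf (suc kk) (p ∷ P) v ≟ᶠ h))
    ≡ ∑ (interval lo c) (λ v → if b v then 0 else 𝟙 (suc (groupOf kk P v) ≟ᶠ h))
∑-groupOf-above c lo kk p P b p≤lo h = ∑-cong (interval lo c) λ {v} v∈ →
  cong (λ g → if b v then 0 else 𝟙 (g ≟ᶠ h))
       (groupOf-above kk p P v (≤-<-trans p≤lo (proj₁ (∈-interval⁻ lo c v∈))))

boundary-above : ∀ {x} lo top P → All (x <_) P → x ≤ top → x < boundary lo top P 1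
boundary-above lo top []      _         x≤top = s≤s x≤top
boundary-above lo top (p ∷ P) (x<p ∷ _) _     = x<p

-- Gap count: let the points P of (lo, lo+c] be those selected by b.  The
-- unselected points of group h are those strictly between the h-th and the
-- (h+1)-th boundary, and there are boundary (h+1) - boundary h - 1 of them.
-- Induction on c, according to whether lo+1 is selected.
gap-count : ∀ c lo top (b : ℕ → Bool) → lo + c ≡ top →
  let P = filterᵇ b (interval lo c) in ∀ (h : Fin (suc (length P))) →
  ∑ (interval lo c) (λ v → if b v then 0 else 𝟙 (groupOf (length P) P v ≟ᶠ h))
    ≡ boundary lo top P (suc (toℕ h)) ∸ boundary lo top P (toℕ h) ∸ 1
gap-count zero    lo top b refl zero = sym (subst (λ t → suc t ∸ lo ∸ 1 ≡ 0) (sym (+-identityʳ lo)) (gap-empty lo))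
gap-count (suc c) lo top b lo+c≡top h with b (suc lo)
... | true  = selected h
  where
  P′ = filterᵇ b (interval (suc lo) c)
  IH = gap-count c (suc lo) top b (trans (sym (+-suc lo c)) lo+c≡top)
  -- lo+1 is the first pivot: group 0 is empty and the others are those of P′.
  selected : ∀ h → ∑ (interval (suc lo) c) (λ v → if b v then 0 else 𝟙 (groupOf (suc (length P′)) (suc lo ∷ P′) v ≟ᶠ h))
                   ≡ boundary lo top (suc lo ∷ P′) (suc (toℕ h)) ∸ boundary lo top (suc lo ∷ P′) (toℕ h) ∸ 1
  selected zero     = begin
    _ ≡⟨ ∑-groupOf-above c (suc lo) (length P′) (suc lo) P′ b ≤-refl zero ⟩
    _ ≡⟨ ∑-cong (interval (suc lo) c) (λ {v} _ → if-same (b v)) ⟩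
    _ ≡⟨ ∑-zero (interval (suc lo) c) ⟩
    0 ≡⟨ gap-empty lo ⟨
    _ ∎
    where open ≡-Reasoning
  selected (suc h′) = begin
    _ ≡⟨ ∑-groupOf-above c (suc lo) (length P′) (suc lo) P′ b ≤-refl (suc h′) ⟩
    _ ≡⟨ IH h′ ⟩
    _ ≡⟨ cong₂ (λ x y → x ∸ y ∸ 1) (boundary-cons lo top P′ (suc (toℕ h′))) (boundary-cons lo top P′ (toℕ h′)) ⟨
    _ ∎
    where open ≡-Reasoning
... | false = unselected h
  where
  P′ = filterᵇ b (interval (suc lo) c)
  IH = gap-count c (suc lo) top b (trans (sym (+-suc lo c)) lo+c≡top)
  P′-above : All (suc lo <_) P′
  P′-above = All.tabulate (λ p∈ → proj₁ (∈-interval⁻ (suc lo) c (proj₁ (∈-filter⁻ (T? ∘ b) p∈))))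
  -- lo+1 is an extra point of group 0; the other groups are those of P′.
  unselected : ∀ h → 𝟙 (groupOf (length P′) P′ (suc lo) ≟ᶠ h)
                     + ∑ (interval (suc lo) c) (λ v → if b v then 0 else 𝟙 (groupOf (length P′) P′ v ≟ᶠ h))
                   ≡ boundary lo top P′ (suc (toℕ h)) ∸ boundary lo top P′ (toℕ h) ∸ 1
  unselected h rewrite groupOf-below (length P′) P′ (suc lo) P′-above | IH h with h
  ... | zero    = trans (cong (λ x → suc (x ∸ suc lo ∸ 1)) (boundary-suc (suc lo) lo top P′ 0))
                        (gap-extend _ lo (boundary-above lo top P′ P′-above lo+1≤top))
    where lo+1≤top = ≤-trans (s≤s (m≤m+n lo c)) (≤-reflexive (trans (sym (+-suc lo c)) lo+c≡top))
  ... | suc h′ = cong₂ (λ x y → x ∸ y ∸ 1) (boundary-suc (suc lo) lo top P′ (suc (toℕ h′)))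
                                            (boundary-suc (suc lo) lo top P′ (toℕ h′))

occurs : List ℕ → ℕ → Bool
occurs ys v = any (λ y → v ≡ᵇ y) ys

occurs-∈ : ∀ {v ys} → v ∈ ys → occurs ys v ≡ true
occurs-∈ {v} v∈ = Equivalence.to T-≡ (any⁺ (v ≡ᵇ_) (Any.map (λ { refl → ≡⇒≡ᵇ v v refl }) v∈))

occurs-∉ : ∀ {v ys} → v ∉ ys → occurs ys v ≡ false
occurs-∉ {v} {ys} v∉ with occurs ys v in occ
... | false = refl
... | true  = contradiction (Any.map (≡ᵇ⇒≡ v _) (any⁻ (v ≡ᵇ_) ys (Equivalence.from T-≡ occ))) v∉

++-disjoint : ∀ (xs : List ℕ) {ys} → Unique (xs ++ ys) → ∀ {v} → v ∈ xs → v ∉ ys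
++-disjoint (x ∷ xs) (x∉ ∷ _) (here refl) v∈ys = All.lookup x∉ (∈-++⁺ʳ xs v∈ys) refl
++-disjoint (x ∷ xs) (_ ∷ u)  (there v∈)  = ++-disjoint xs u v∈

input-unique : ∀ n {e} → e ∈ inputs n → Unique e
input-unique n e∈ = Unique-resp-↭ (↭⇒↭ₛ (↭-sym (∈-inputs⁻ n e∈))) (interval-unique 0 n)
  where open import Data.List.Relation.Binary.Permutation.Setoid.Properties (setoid ℕ) using (Unique-resp-↭)

∑-take-drop : ∀ n k {e} → e ∈ inputs n → (g : ℕ → ℕ) → ∑ (interval 0 n) g ≡ ∑ (take k e) g + ∑ (drop k e) g
∑-take-drop n k {e} e∈ g = begin
  ∑ (interval 0 n) g          ≡⟨ ∑-↭ g (∈-inputs⁻ n e∈) ⟨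
  ∑ e g                       ≡⟨ cong (λ l → ∑ l g) (take++drop≡id k e) ⟨
  ∑ (take k e ++ drop k e) g  ≡⟨ ∑-++ (take k e) (drop k e) g ⟩
  ∑ (take k e) g + ∑ (drop k e) g ∎
  where open ≡-Reasoning

∑-drop : ∀ n k {e} → e ∈ inputs n → (f : ℕ → ℕ) →
         ∑ (drop k e) f ≡ ∑ (interval 0 n) (λ v → if occurs (take k e) v then 0 else f v)
∑-drop n k {e} e∈ f = sym (begin
  ∑ (interval 0 n) g                  ≡⟨ ∑-take-drop n k e∈ g ⟩
  ∑ (take k e) g + ∑ (drop k e) g     ≡⟨ cong₂ _+_ (trans (∑-cong (take k e) on-pivots) (∑-zero (take k e)))
                                                   (∑-cong (drop k e) on-others) ⟩
  0 + ∑ (drop k e) f                  ∎)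
  where
  open ≡-Reasoning
  g = λ v → if occurs (take k e) v then 0 else f v
  on-pivots : ∀ {v} → v ∈ take k e → g v ≡ 0
  on-pivots v∈ = cong (λ t → if t then 0 else f _) (occurs-∈ v∈)
  on-others : ∀ {v} → v ∈ drop k e → g v ≡ f v
  on-others v∈ = cong (λ t → if t then 0 else f _) (occurs-∉ (λ v∈take →
    ++-disjoint (take k e) (subst Unique (sym (take++drop≡id k e)) (input-unique n e∈)) v∈take v∈))

length-pivots : ∀ n k {e} → k ≤ n → e ∈ inputs n → length (pivots n k e) ≡ k
length-pivots n k {e} k≤n e∈ = begin
  length (filterᵇ b (applyUpTo suc n))   ≡⟨ cong (length ∘ filterᵇ b) (applyUpTo-suc n) ⟩
  length (filterᵇ b (interval 0 n))      ≡⟨ length-as-∑ (filterᵇ b (interval 0 n)) ⟩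
  ∑ (filterᵇ b (interval 0 n)) (λ _ → 1) ≡⟨ trans (∑-filter-const (T? ∘ b) (interval 0 n) 1) (*-identityʳ _) ⟩
  ∑ (interval 0 n) ind                   ≡⟨ ∑-take-drop n k e∈ ind ⟩
  ∑ (take k e) ind + ∑ (drop k e) ind    ≡⟨ cong₂ _+_ (∑-cong (take k e) (cong ind-of ∘ occurs-∈))
                                                      (∑-cong (drop k e) (cong ind-of ∘ not-pivot)) ⟩
  ∑ (take k e) (λ _ → 1) + ∑ (drop k e) (λ _ → 0) ≡⟨ cong₂ _+_ (sym (length-as-∑ (take k e))) (∑-zero (drop k e)) ⟩
  length (take k e) + 0                  ≡⟨ +-identityʳ _ ⟩
  length (take k e)                      ≡⟨ length-take k e ⟩
  k ⊓ length e                           ≡⟨ m≤n⇒m⊓n≡m (≤-trans k≤n (≤-reflexive (sym (length-input n e∈)))) ⟩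
  k ∎
  where
  open ≡-Reasoning
  b = occurs (take k e)
  ind-of : Bool → ℕ
  ind-of t = if t then 1 else 0
  ind = λ v → ind-of (b v)
  length-as-∑ : ∀ (L : List ℕ) → length L ≡ ∑ L (λ _ → 1)
  length-as-∑ L = sym (trans (∑-const L 1) (*-identityʳ _))
  not-pivot : ∀ {v} → v ∈ drop k e → b v ≡ false
  not-pivot v∈ = occurs-∉ (λ v∈take →
    ++-disjoint (take k e) (subst Unique (sym (take++drop≡id k e)) (input-unique n e∈)) v∈take v∈)

∑-interval-suc : ∀ lo c (g : ℕ → ℕ) → ∑ (interval (suc lo) c) g ≡ ∑ (interval lo c) (g ∘ suc)
∑-interval-suc lo zero    g = refl
∑-interval-suc lo (suc c) g = cong (g (suc (suc lo)) +_) (∑-interval-suc (suc lo) c g)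

∑-elemAt-tail : ∀ lo c x xs (f : ℕ → ℕ) →
                ∑ (interval (suc lo) c) (f ∘ elemAt (x ∷ xs)) ≡ ∑ (interval lo c) (f ∘ elemAt xs)
∑-elemAt-tail lo c x xs f = trans (∑-interval-suc lo c _) (∑-cong (interval lo c) λ {j} j∈ →
  cong f (tail-entry j (≤-trans (s≤s z≤n) (proj₁ (∈-interval⁻ lo c j∈)))))
  where
  tail-entry : ∀ j → 0 < j → elemAt (x ∷ xs) (suc j) ≡ elemAt xs j
  tail-entry (suc j) _ = refl

∑-positions : ∀ k e (f : ℕ → ℕ) → k ≤ length e → ∑ (interval k (length e ∸ k)) (f ∘ elemAt e) ≡ ∑ (drop k e) f
∑-positions zero    []       f _         = refl
∑-positions zero    (x ∷ xs) f _         = cong (f x +_) (trans (∑-elemAt-tail 0 (length xs) x xs f)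
                                                                (∑-positions zero xs f z≤n))
∑-positions (suc k) (x ∷ xs) f (s≤s k≤) = trans (∑-elemAt-tail k (length xs ∸ k) x xs f) (∑-positions k xs f k≤)

group-count : ∀ n k {e} → k ≤ n → e ∈ inputs n → let P = pivots n k e in ∀ (h : Fin (suc k)) →
              ∑ (interval k (n ∸ k)) (λ j → 𝟙 (groupOf k P (elemAt e j) ≟ᶠ h)) ≡ groupSize n k P h
group-count n k {e} k≤n e∈ h = begin
  ∑ (interval k (n ∸ k)) (f ∘ elemAt e)
    ≡⟨ cong (λ m → ∑ (interval k (m ∸ k)) (f ∘ elemAt e)) (sym len) ⟩
  ∑ (interval k (length e ∸ k)) (f ∘ elemAt e)
    ≡⟨ ∑-positions k e f (≤-trans k≤n (≤-reflexive (sym len))) ⟩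
  ∑ (drop k e) f
    ≡⟨ ∑-drop n k e∈ f ⟩
  ∑ (interval 0 n) (λ v → if b v then 0 else f v)
    ≡⟨ gap-count-at (cong (filterᵇ b) (applyUpTo-suc n)) (length-pivots n k k≤n e∈) h ⟩
  boundary 0 n P (suc (toℕ h)) ∸ boundary 0 n P (toℕ h) ∸ 1
    ≡⟨ cong₂ (λ x y → x ∸ y ∸ 1) (pivotAt≡boundary n P (suc (toℕ h))) (pivotAt≡boundary n P (toℕ h)) ⟨
  groupSize n k P h ∎
  where
  open ≡-Reasoning
  b = occurs (take k e)
  P = pivots n k e
  f = λ v → 𝟙 (groupOf k P v ≟ᶠ h)
  len = length-input n e∈
  gap-count-at : ∀ {kk Q} → Q ≡ filterᵇ b (interval 0 n) → length Q ≡ kk → ∀ (h : Fin (suc kk)) →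
                 ∑ (interval 0 n) (λ v → if b v then 0 else 𝟙 (groupOf kk Q v ≟ᶠ h))
                   ≡ boundary 0 n Q (suc (toℕ h)) ∸ boundary 0 n Q (toℕ h) ∸ 1
  gap-count-at refl refl = gap-count n 0 n b refl

module Exchange (n k : ℕ) (k≤n : k ≤ n) (P : List ℕ) where

  grp : List ℕ → ℕ → Fin (suc k)
  grp e j = groupOf k P (elemAt e j)

  comparisonsOn : ∀ {d} → ClassTree k d → List ℕ → ℕ
  comparisonsOn T e = run T (grp e)

  Free : List ℕ → ℕ → Set
  Free used i = (k < i × i ≤ n) × i ∉ used

  laterPositions : List ℕ
  laterPositions = interval k (n ∸ k)

  ∈-laterPositions⁻ : ∀ {j} → j ∈ laterPositions → k < j × j ≤ n
  ∈-laterPositions⁻ j∈ with ∈-interval⁻ k (n ∸ k) j∈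
  ... | k<j , j≤ = k<j , ≤-trans j≤ (≤-reflexive (m+[n∸m]≡n k≤n))

  ∈-laterPositions⁺ : ∀ {j} → k < j → j ≤ n → j ∈ laterPositions
  ∈-laterPositions⁺ k<j j≤n = ∈-interval⁺ k (n ∸ k) k<j (≤-trans j≤n (≤-reflexive (sym (m+[n∸m]≡n k≤n))))

  free : List ℕ → List ℕ
  free used = filter (λ j → ¬? (j ∈? used)) laterPositions

  ∈-free⁻ : ∀ {used j} → j ∈ free used → Free used j
  ∈-free⁻ {used} j∈ with ∈-filter⁻ (λ j → ¬? (j ∈? used)) j∈
  ... | j∈later , j∉ = ∈-laterPositions⁻ j∈later , j∉

  ∈-free⁺ : ∀ {used j} → Free used j → j ∈ free used
  ∈-free⁺ {used} ((k<j , j≤n) , j∉) = ∈-filter⁺ (λ j → ¬? (j ∈? used)) (∈-laterPositions⁺ k<j j≤n) j∉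

  free-unique : ∀ used → Unique (free used)
  free-unique used = Unique.filter⁺ (λ j → ¬? (j ∈? used)) (interval-unique k (n ∸ k))

  free-remove : ∀ {used i} → Free used i → free used ↭ i ∷ free (i ∷ used)
  free-remove {used} {i} i-free = ↭-by-elements (free-unique used)
    (All.tabulate (λ j∈ i≡j → proj₂ (∈-free⁻ j∈) (here (sym i≡j))) ∷ free-unique (i ∷ used))
    (mk⇔ to from)
    where
    to : ∀ {j} → j ∈ free used → j ∈ i ∷ free (i ∷ used)
    to {j} j∈ with j ≟ i
    ... | yes refl = here refl
    ... | no  j≢i  = there (∈-free⁺ (proj₁ (∈-free⁻ j∈) , not-used))
      where
      not-used : j ∉ i ∷ used
      not-used (here j≡i)     = j≢i j≡i
      not-used (there j∈used) = proj₂ (∈-free⁻ j∈) j∈used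
    from : ∀ {j} → j ∈ i ∷ free (i ∷ used) → j ∈ free used
    from (here refl) = ∈-free⁺ i-free
    from (there j∈)  = ∈-free⁺ (proj₁ (∈-free⁻ j∈) , proj₂ (∈-free⁻ j∈) ∘ there)

  remaining : List ℕ → List ℕ → Fin (suc k) → ℕ
  remaining used e h = ∑ (free used) (λ j → 𝟙 (grp e j ≟ᶠ h))

  remaining-split : ∀ {used i} → Free used i → ∀ e h →
                    remaining used e h ≡ 𝟙 (grp e i ≟ᶠ h) + remaining (i ∷ used) e h
  remaining-split i-free e h = ∑-↭ (λ j → 𝟙 (grp e j ≟ᶠ h)) (free-remove i-free)

  -- The invariant of the exchange argument, for a list L of inputs sharing the
  -- pivots P whose remaining group sizes are a′ after classifying the positions in used.
  record Balanced (used : List ℕ) (a′ : Fin (suc k) → ℕ) (L : List (List ℕ)) : Set where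
    field
      lengths   : ∀ {e} → e ∈ L → length e ≡ n
      symmetric : ∀ {i j} → Free used i → Free used j → Invariant (swapAt i j) L
      counts    : ∀ {e} → e ∈ L → ∀ h → remaining used e h ≡ a′ h

  grp-swapAt : ∀ {used i j e} → Free used i → Free used j → length e ≡ n →
               ∀ x → grp (swapAt i j e) x ≡ grp e (transpose i j x)
  grp-swapAt {e = e} ((k<i , i≤n) , _) ((k<j , j≤n) , _) len x = cong (groupOf k P)
    (elemAt-swapAt e (≤-trans (s≤s z≤n) k<i , ≤-trans i≤n (≤-reflexive (sym len)))
                     (≤-trans (s≤s z≤n) k<j , ≤-trans j≤n (≤-reflexive (sym len))) x)

  relabel : ∀ {d} → ℕ → ℕ → ClassTree k d → ClassTree k d
  relabel i j leaf           = leaf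
  relabel i j (node x λt ch) = node (transpose i j x) λt (relabel i j ∘ ch)

  run-relabel : ∀ {d} i j (T : ClassTree k d) (g : ℕ → Fin (suc k)) →
                run (relabel i j T) g ≡ run T (g ∘ transpose i j)
  run-relabel i j leaf           g = refl
  run-relabel i j (node x λt ch) g = cong (depth λt (toℕ (g (transpose i j x))) +_)
                                          (run-relabel i j (ch (g (transpose i j x))) g)

  run-cong : ∀ {d} (T : ClassTree k d) {g g′ : ℕ → Fin (suc k)} → (∀ x → g x ≡ g′ x) → run T g ≡ run T g′
  run-cong leaf           _  = refl
  run-cong (node x λt ch) {g} {g′} g≗g′ rewrite g≗g′ x =
    cong (depth λt (toℕ (g′ x)) +_) (run-cong (ch (g′ x)) g≗g′)

  relabel-valid : ∀ {d i j} → (k < i × i ≤ n) → (k < j × j ≤ n) → (T : ClassTree k d) {U V : List ℕ} →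
                  (∀ {x} → transpose i j x ∈ V → x ∈ U) → ValidCT n k U T → ValidCT n k V (relabel i j T)
  relabel-valid i-rng j-rng leaf           _    _ = _
  relabel-valid {i = i} {j} i-rng j-rng (node x λt ch) {U} {V} back (x-rng , x∉U , valid-ch) =
    transpose-closed (λ y → k < y × y ≤ n) i-rng j-rng x-rng , x∉U ∘ back ,
    λ h → relabel-valid i-rng j-rng (ch h) back′ (valid-ch h)
    where
    back′ : ∀ {y} → transpose i j y ∈ transpose i j x ∷ V → y ∈ x ∷ U
    back′ (here eq)   = here (transpose-injective i j eq)
    back′ (there y∈V) = there (back y∈V)

  relabel-valid-free : ∀ {d used i j} → Free used i → Free used j → (T : ClassTree k d) →
                       ValidCT n k used T → ValidCT n k used (relabel i j T)
  relabel-valid-free {used = used} {i} {j} (i-rng , i∉) (j-rng , j∉) T = relabel-valid i-rng j-rng T fixed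
    where
    -- used avoids i and j, so the transposition fixes it pointwise.
    fixed : ∀ {x} → transpose i j x ∈ used → x ∈ used
    fixed {x} τx∈ = subst (_∈ used) τx≡x τx∈
      where
      at : ∀ {y} → transpose i j x ≡ y → y ∈ used
      at refl = τx∈
      τx≡x : transpose i j x ≡ x
      τx≡x = trans (sym (transpose-other i j (i∉ ∘ at) (j∉ ∘ at))) (transpose-involutive i j x)

  ∑-relabel : ∀ {d used a′ L i j} → Balanced used a′ L → Free used i → Free used j → (T : ClassTree k d) →
              ∑ L (comparisonsOn (relabel i j T)) ≡ ∑ L (comparisonsOn T)
  ∑-relabel {L = L} {i} {j} bal i-free j-free T = begin
    ∑ L (λ e → run (relabel i j T) (grp e))        ≡⟨ ∑-cong L (λ {e} _ → run-relabel i j T (grp e)) ⟩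
    ∑ L (λ e → run T (grp e ∘ transpose i j))      ≡⟨ ∑-cong L (λ {e} e∈ → run-cong T (sym ∘ grp-swapAt {e = e} i-free j-free (lengths e∈))) ⟩
    ∑ L (λ e → run T (grp (swapAt i j e)))         ≡⟨ symmetric i-free j-free (comparisonsOn T) ⟩
    ∑ L (comparisonsOn T)                          ∎
    where
    open ≡-Reasoning
    open Balanced bal

  groupCount : ℕ → Fin (suc k) → List (List ℕ) → ℕ
  groupCount i h = count (λ e → grp e i ≟ᶠ h)

  groupCount-symmetric : ∀ {used a′ L i j} → Balanced used a′ L → Free used i → Free used j → ∀ h →
                         groupCount j h L ≡ groupCount i h L
  groupCount-symmetric {L = L} {i} {j} bal i-free j-free h = begin
    ∑ L (λ e → 𝟙 (grp e j ≟ᶠ h))                 ≡⟨ ∑-cong L (λ {e} e∈ → cong (λ g → 𝟙 (g ≟ᶠ h)) (at-i e∈)) ⟩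
    ∑ L (λ e → 𝟙 (grp (swapAt i j e) i ≟ᶠ h))    ≡⟨ symmetric i-free j-free (λ e → 𝟙 (grp e i ≟ᶠ h)) ⟩
    ∑ L (λ e → 𝟙 (grp e i ≟ᶠ h))                 ∎
    where
    open ≡-Reasoning
    open Balanced bal
    at-i : ∀ {e} → e ∈ L → grp e j ≡ grp (swapAt i j e) i
    at-i {e} e∈ = sym (trans (grp-swapAt {e = e} i-free j-free (lengths e∈) i) (cong (grp e) (transpose-left i j)))

  -- Double counting: summing the group counts over the free positions counts the
  -- remaining elements of group h in every input.
  groupCount-free : ∀ {used a′ L i} → Balanced used a′ L → Free used i → ∀ h →
                    length (free used) * groupCount i h L ≡ length L * a′ h
  groupCount-free {used} {a′} {L} {i} bal i-free h = begin
    length (free used) * groupCount i h L              ≡⟨ ∑-const (free used) _ ⟨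
    ∑ (free used) (λ _ → groupCount i h L)             ≡⟨ ∑-cong (free used) (λ j∈ → sym (same-count j∈)) ⟩
    ∑ (free used) (λ j → ∑ L (λ e → 𝟙 (grp e j ≟ᶠ h))) ≡⟨ ∑-comm (free used) L _ ⟩
    ∑ L (λ e → remaining used e h)                     ≡⟨ ∑-cong L (λ e∈ → counts e∈ h) ⟩
    ∑ L (λ _ → a′ h)                                   ≡⟨ ∑-const L (a′ h) ⟩
    length L * a′ h                                    ∎
    where
    open ≡-Reasoning
    open Balanced bal
    same-count : ∀ {j} → j ∈ free used → groupCount j h L ≡ groupCount i h L
    same-count j∈ = groupCount-symmetric bal i-free (∈-free⁻ j∈) h

  root-cost : ∀ {used a′ L i} → Balanced used a′ L → Free used i → (λt : CompTree k) →
              length (free used) * ∑ L (λ e → depth λt (toℕ (grp e i))) ≡ length L * cost λt a′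
  root-cost {used} {a′} {L} {i} bal i-free λt = begin
    m * ∑ L (λ e → D (grp e i))
      ≡⟨ cong (m *_) (∑-fibres _≟ᶠ_ (λ e → grp e i) (Unique.allFin⁺ (suc k)) L (λ _ → ∈-allFin _) (λ _ h → D h)) ⟩
    m * ∑ AF (λ h → ∑ (fibre _≟ᶠ_ (λ e → grp e i) h L) (λ _ → D h))
      ≡⟨ cong (m *_) (∑-cong AF (λ {h} _ → ∑-filter-const (λ e → grp e i ≟ᶠ h) L (D h))) ⟩
    m * ∑ AF (λ h → groupCount i h L * D h)
      ≡⟨ ∑-*ˡ AF m _ ⟨
    ∑ AF (λ h → m * (groupCount i h L * D h))
      ≡⟨ ∑-cong AF (λ {h} _ → rescale (groupCount-free bal i-free h)) ⟩
    ∑ AF (λ h → N * (D h * a′ h))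
      ≡⟨ ∑-*ˡ AF N _ ⟩
    N * cost λt a′ ∎
    where
    open ≡-Reasoning
    D : Fin (suc k) → ℕ
    D h = depth λt (toℕ h)
    m = length (free used)
    N = length L
    AF = allFin (suc k)
    rescale : ∀ {c a d} → m * c ≡ N * a → m * (c * d) ≡ N * (d * a)
    rescale {c} {a} {d} mc≡Na = begin
      m * (c * d)  ≡⟨ *-assoc m c d ⟨
      m * c * d    ≡⟨ cong (_* d) mc≡Na ⟩
      N * a * d    ≡⟨ *-assoc N a d ⟩
      N * (a * d)  ≡⟨ cong (N *_) (*-comm a d) ⟩
      N * (d * a)  ∎

  root-optimal : ∀ {used a′ L i} → Balanced used a′ L → Free used i → {λO λT : CompTree k} →
                 cost λO a′ ≤ cost λT a′ →
                 ∑ L (λ e → depth λO (toℕ (grp e i))) ≤ ∑ L (λ e → depth λT (toℕ (grp e i)))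
  root-optimal {used} {a′} {L} {i} bal i-free {λO} {λT} cheaper =
    *-cancelˡ-≤ (length (free used)) {{nonzero (∈-free⁺ i-free)}}
      (subst₂ _≤_ (sym (root-cost bal i-free λO)) (sym (root-cost bal i-free λT)) (*-monoʳ-≤ (length L) cheaper))
    where
    nonzero : ∀ {xs : List ℕ} {x} → x ∈ xs → NonZero (length xs)
    nonzero (here _)  = _
    nonzero (there _) = _

  atGroup : ℕ → Fin (suc k) → List (List ℕ) → List (List ℕ)
  atGroup i = fibre _≟ᶠ_ (λ e → grp e i)

  decAt-𝟙 : ∀ (a′ : Fin (suc k) → ℕ) h h′ {c} → a′ h′ ≡ 𝟙 (h ≟ᶠ h′) + c → decAt a′ h h′ ≡ c
  decAt-𝟙 a′ h h′ eq with h′ ≟ᶠ h | h ≟ᶠ h′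
  ... | yes refl | yes _    = cong (_∸ 1) eq
  ... | yes refl | no h≢h   = contradiction refl h≢h
  ... | no h′≢h  | yes h≡h′ = contradiction (sym h≡h′) h′≢h
  ... | no _     | no _     = eq

  atGroup-balanced : ∀ {used a′ L i} → Balanced used a′ L → Free used i → ∀ h →
                     Balanced (i ∷ used) (decAt a′ h) (atGroup i h L)
  atGroup-balanced {used} {a′} {L} {i} bal i-free h = record
    { lengths   = λ e∈ → lengths (proj₁ (∈-filter⁻ (λ e → grp e i ≟ᶠ h) e∈))
    ; symmetric = λ j-free j′-free →
        filter-invariant (λ e → grp e i ≟ᶠ h) (fixes-i j-free j′-free) (symmetric (forget j-free) (forget j′-free))
    ; counts    = λ e∈ h′ → after-i (∈-filter⁻ (λ e → grp e i ≟ᶠ h) e∈) h′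
    }
    where
    open Balanced bal
    forget : ∀ {j} → Free (i ∷ used) j → Free used j
    forget (j-rng , j∉) = j-rng , j∉ ∘ there
    fixes-i : ∀ {j j′} → Free (i ∷ used) j → Free (i ∷ used) j′ → ∀ {e} → e ∈ L →
              does (grp (swapAt j j′ e) i ≟ᶠ h) ≡ does (grp e i ≟ᶠ h)
    fixes-i {j} {j′} j-free j′-free {e} e∈ = cong (λ g → does (g ≟ᶠ h))
      (trans (grp-swapAt {e = e} (forget j-free) (forget j′-free) (lengths e∈) i)
             (cong (grp e) (transpose-other j j′ (λ { refl → proj₂ j-free (here refl) })
                                                 (λ { refl → proj₂ j′-free (here refl) }))))
    after-i : ∀ {e} → e ∈ L × grp e i ≡ h → ∀ h′ → remaining (i ∷ used) e h′ ≡ decAt a′ h h′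
    after-i {e} (e∈ , refl) h′ =
      sym (decAt-𝟙 a′ h h′ (trans (sym (counts e∈ h′)) (remaining-split i-free e h′)))

  exchange : ∀ {d used a′ L} (O T : ClassTree k d) → ValidCT n k used O → ValidCT n k used T →
             OptNodes a′ O → Balanced used a′ L → ∑ L (comparisonsOn O) ≤ ∑ L (comparisonsOn T)

  exchange-aligned : ∀ {d used a′ L i t} {λO λT : CompTree k} {chO chT : Fin (suc k) → ClassTree k d} →
                     t ≡ i → ValidCT n k used (node i λO chO) → ValidCT n k used (node t λT chT) →
                     OptNodes a′ (node i λO chO) → Balanced used a′ L →
                     ∑ L (comparisonsOn (node i λO chO)) ≤ ∑ L (comparisonsOn (node t λT chT))

  exchange leaf leaf _ _ _ _ = ≤-refl
  exchange {L = L} O@(node i _ _) T@(node t _ _) vO vT opt bal = begin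
    ∑ L (comparisonsOn O)                ≤⟨ exchange-aligned (transpose-right i t) vO
                                              (relabel-valid-free i-free t-free T vT) opt bal ⟩
    ∑ L (comparisonsOn (relabel i t T))  ≡⟨ ∑-relabel bal i-free t-free T ⟩
    ∑ L (comparisonsOn T)                ∎
    where
    open ≤-Reasoning
    i-free = proj₁ vO , proj₁ (proj₂ vO)
    t-free = proj₁ vT , proj₁ (proj₂ vT)

  exchange-aligned {L = L} {i} {λO = λO} {λT} {chO} {chT} refl vO@(_ , _ , validO) (_ , _ , validT) (λO-opt , chO-opt) bal =
    begin
      ∑ L (λ e → depth λO (toℕ (grp e i)) + run (chO (grp e i)) (grp e))
        ≡⟨ ∑-+ L _ _ ⟩
      ∑ L (λ e → depth λO (toℕ (grp e i))) + ∑ L (λ e → run (chO (grp e i)) (grp e))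
        ≤⟨ +-mono-≤ (root-optimal bal i-free (λO-opt λT)) children ⟩
      ∑ L (λ e → depth λT (toℕ (grp e i))) + ∑ L (λ e → run (chT (grp e i)) (grp e))
        ≡⟨ ∑-+ L _ _ ⟨
      ∑ L (λ e → depth λT (toℕ (grp e i)) + run (chT (grp e i)) (grp e))
    ∎
    where
    open ≤-Reasoning
    i-free = proj₁ vO , proj₁ (proj₂ vO)
    by-outcome : (ch : Fin (suc k) → ClassTree k _) →
                 ∑ L (λ e → run (ch (grp e i)) (grp e)) ≡ ∑ (allFin (suc k)) (λ h → ∑ (atGroup i h L) (comparisonsOn (ch h)))
    by-outcome ch = ∑-fibres _≟ᶠ_ (λ e → grp e i) (Unique.allFin⁺ (suc k)) L (λ _ → ∈-allFin _)
                             (λ e h → run (ch h) (grp e))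
    children : ∑ L (λ e → run (chO (grp e i)) (grp e)) ≤ ∑ L (λ e → run (chT (grp e i)) (grp e))
    children = subst₂ _≤_ (sym (by-outcome chO)) (sym (by-outcome chT))
      (∑-mono (allFin (suc k)) (λ {h} _ →
        exchange (chO h) (chT h) (validO h) (validT h) (chO-opt h) (atGroup-balanced bal i-free h)))

/-mono-≤ : ∀ a b d .{{_ : NonZero d}} → a ≤ b → (ℤ.+ a) / d ≤ℚ (ℤ.+ b) / d
/-mono-≤ a b (suc d) a≤b = toℚᵘ-cancel-≤ (begin
  toℚᵘ (fromℚᵘ (mkℚᵘ (ℤ.+ a) d)) ≃⟨ toℚᵘ-fromℚᵘ (mkℚᵘ (ℤ.+ a) d) ⟩
  mkℚᵘ (ℤ.+ a) d                 ≤⟨ *≤* (ℤₚ.*-monoʳ-≤-nonNeg (ℤ.+ suc d) (ℤ.+≤+ a≤b)) ⟩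
  mkℚᵘ (ℤ.+ b) d                 ≃⟨ ℚᵘ.≃-sym (toℚᵘ-fromℚᵘ (mkℚᵘ (ℤ.+ b) d)) ⟩
  toℚᵘ (fromℚᵘ (mkℚᵘ (ℤ.+ b) d)) ∎)
  where open ℚᵘ.≤-Reasoning

module Inputs (n k : ℕ) (k<n : k < n) where

  k≤n : k ≤ n
  k≤n = <⇒≤ k<n

  _≟ᴸ_ : DecidableEquality (List ℕ)
  _≟ᴸ_ = ≡-dec _≟_

  pivots-swapAt : ∀ {i j e} → k < i → i ≤ n → k < j → j ≤ n → e ∈ inputs n →
                  pivots n k (swapAt i j e) ≡ pivots n k e
  pivots-swapAt {i} {j} {e} k<i i≤n k<j j≤n e∈ =
    cong (λ t → filterᵇ (occurs t) (applyUpTo suc n)) (take-swapAt k e (position k<i i≤n) (position k<j j≤n) k<i k<j)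
    where
    position : ∀ {p} → k < p → p ≤ n → Position e p
    position k<p p≤n = ≤-trans (s≤s z≤n) k<p , ≤-trans p≤n (≤-reflexive (sym (length-input n e∈)))

  withPivots : List ℕ → List (List ℕ)
  withPivots P = fibre _≟ᴸ_ (pivots n k) P (inputs n)

  ∈-withPivots⁻ : ∀ {P e} → e ∈ withPivots P → e ∈ inputs n × pivots n k e ≡ P
  ∈-withPivots⁻ {P} = ∈-filter⁻ (λ e → pivots n k e ≟ᴸ P) {xs = inputs n}

  withPivots-balanced : ∀ P → Exchange.Balanced n k k≤n P [] (groupSize n k P) (withPivots P)
  withPivots-balanced P = record
    { lengths   = λ e∈ → length-input n (proj₁ (∈-withPivots⁻ e∈))
    ; symmetric = λ { ((k<i , i≤n) , _) ((k<j , j≤n) , _) →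
        filter-invariant (λ e → pivots n k e ≟ᴸ P)
                         (λ e∈ → cong (λ Q → does (Q ≟ᴸ P)) (pivots-swapAt k<i i≤n k<j j≤n e∈))
                         (inputs-invariant n (≤-trans (s≤s z≤n) k<i) i≤n (≤-trans (s≤s z≤n) k<j) j≤n) }
    ; counts    = λ e∈ h → initial (∈-withPivots⁻ e∈) h
    }
    where
    open Exchange n k k≤n P
    nothing-classified : free [] ≡ laterPositions
    nothing-classified = filter-all _ (All.tabulate (λ _ ()))
    initial : ∀ {e} → e ∈ inputs n × pivots n k e ≡ P → ∀ h → remaining [] e h ≡ groupSize n k P h
    initial {e} (e∈ , refl) h = trans (cong (λ js → ∑ js (λ j → 𝟙 (grp e j ≟ᶠ h))) nothing-classified)
                                      (group-count n k k≤n e∈ h)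

  -- On the inputs with pivots P, strategy O uses the trees O P and X uses X P,
  -- so the exchange argument compares them.
  withPivots-≤ : (O : Strategy n k) → IsStrategy n k O → IsOk n k O →
                 (X : Strategy n k) → IsStrategy n k X →
                 ∀ {e} → e ∈ inputs n → let P = pivots n k e in
                 ∑ (withPivots P) (comparisons n k O) ≤ ∑ (withPivots P) (comparisons n k X)
  withPivots-≤ O isO okO X isX {e} e∈ =
    subst₂ _≤_ (sym (by-pivots O)) (sym (by-pivots X))
      (exchange (O P) (X P) (isO e e∈) (isX e e∈) (okO e e∈) (withPivots-balanced P))
    where
    P = pivots n k e
    open Exchange n k k≤n P
    by-pivots : (S : Strategy n k) → ∑ (withPivots P) (comparisons n k S) ≡ ∑ (withPivots P) (comparisonsOn (S P))
    by-pivots S = ∑-cong (withPivots P) λ e′∈ → case-pivots (proj₂ (∈-withPivots⁻ e′∈))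
      where
      case-pivots : ∀ {e′} → pivots n k e′ ≡ P → comparisons n k S e′ ≡ comparisonsOn (S P) e′
      case-pivots {e′} eq = cong (λ Q → run (S Q) (λ j → groupOf k Q (elemAt e′ j))) eq

  total-≤ : (O : Strategy n k) → IsStrategy n k O → IsOk n k O →
            (X : Strategy n k) → IsStrategy n k X →
            ∑ (inputs n) (comparisons n k O) ≤ ∑ (inputs n) (comparisons n k X)
  total-≤ O isO okO X isX = ∑-≤-fibrewise _≟ᴸ_ (pivots n k) (inputs n) (withPivots-≤ O isO okO X isX)

-- E(P_n) is the total number of comparisons over the n! inputs divided by n!, so
-- the theorem follows from the comparison of the totals.
theorem5p1 : ∀ (n k : ℕ) → 1 ≤ k → k < n →
    (O : Strategy n k) → IsStrategy n k O → IsOk n k O →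
    (S : Strategy n k) → IsStrategy n k S →
    expectedCost n k O ≤ℚ expectedCost n k S
theorem5p1 n k _ k<n O isO okO S isS =
  /-mono-≤ _ _ (n !) {{n !≢0}} (Inputs.total-≤ n k k<n O isO okO S isS)
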